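{- Let $A$ be a finite set of agents with $|A|\ge2$. If $M^\ast$ is an auxiliary-colour simplicial secrecy model over $A$, then its share model $\mathsf{Sh}(M^\ast)$ is a simplicial secrecy model (with colour set $A$).
   Context: $\mathsf{Prop}$ is a countable set of propositional variables. For a colour set $C$, a $C$-chromatic simplicial complex is $(V,\mathcal{F},\chi)$ where $V$ is non-empty, $\mathcal{F}$ is a non-empty family of finite non-empty subsets of $V$ closed under non-empty subsets, and $\chi:V\to C$ is injective on every face; facets are inclusion-maximal faces, $\mathrm{Fac}$ the set of facets. For a facet $X$ and colour $a$, $v_a(X)$ is the vertex of colour $a$ in $X$; $\mathrm{St}(v)=\{X\in\mathrm{Fac}:v\in X\}$; $X\sim_a Y$ iff $v_a(X)=v_a(Y)$. A simplicial secrecy model is $M=(V,\mathcal{F},\chi,\nu,\{N^S_a\}_{a\in A})$ with $(V,\mathcal{F},\chi)$ $A$-chromatic, every facet $X$ having $\chi[X]=A$, every vertex in some facet, $\nu:\mathrm{Fac}\to\mathcal{P}(\mathsf{Prop})$, and $N_a^S:V_a\to\mathcal{P}(\mathcal{P}(\mathrm{Fac}(M)))$ ($V_a$ = vertices of colour $a$) satisfying (SN): for all $a\in A$, $v\in V_a$, $U\in N_a^S(v)$, $X\in\mathrm{St}(v)$, $b\in A\setminus\{a\}$ there is a facet $Y$ with $X\sim_b Y$ and $Y\notin U$. Fix a fresh colour $\ast\notin A$; an auxiliary-colour simplicial secrecy model over $A$ is the same except that the complex is $(A\cup\{\ast\})$-chromatic and every facet has colour set $A\cup\{\ast\}$ (neighborhoods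 still only for $a\in A$, with (SN) for $a,b\in A$). Share model: let $G=\mathbb{Z}^{(\mathrm{Fac}(M^\ast))}$ be the free abelian group on the facets of $M^\ast$ and $\iota(X)=e_X$ the canonical injection. For a facet $X$ and $\sigma:A\to G$ with $\sum_{a}\sigma(a)=\iota(X)$ put $X^\sigma=\{(a,v_a(X),\sigma(a)):a\in A\}$. $\mathsf{Sh}(M^\ast)$ has as facets all such $X^\sigma$, faces their downward closure, vertices all $(a,v_a(X),\sigma(a))$ occurring in them, colouring $(a,v,g)\mapsto a$, valuation $\nu^{sh}(X^\sigma)=\nu(X)$, and, writing $U^\uparrow=\{Y^\tau\in\mathrm{Fac}(\mathsf{Sh}(M^\ast)):Y\in U\}$ for $U\subseteq\mathrm{Fac}(M^\ast)$, neighborhoods $N_a^{S,sh}((a,v,g))=\{U^\uparrow:U\in N_a^S(v)\}$. -}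

module Defs where

open import Level using (Level; _⊔_; 0ℓ) renaming (suc to lsuc)
open import Data.Nat using (ℕ)
open import Data.Fin using (Fin; zero; suc)
open import Data.Maybe using (Maybe; just; nothing)
open import Data.Product using (Σ; Σ-syntax; _×_; _,_; proj₁; proj₂)
open import Data.List using (List)
open import Data.List.Membership.Propositional using (_∈_)
open import Data.Refinement using (Refinement; _,_; value)
open import Data.Irrelevant using ([_])
open import Relation.Nullary using (¬_)
open import Relation.Unary using (Pred; _⊆_)
open import Relation.Binary.PropositionalEquality using (_≡_; _≢_)
open import Algebra.Structures using (IsAbelianGroup)
open import Algebra.Bundles using (AbelianGroup)
open import Function using (_∘_)

-- Prop is the countable set ℕ; a valuation value is a subset of ℕ.
PropVar : Set
PropVar = ℕ

_≐_ : ∀ {a ℓ} {V : Set a} → Pred V ℓ → Pred V ℓ → Set (a ⊔ ℓ)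
P ≐ Q = (P ⊆ Q) × (Q ⊆ P)

NonEmpty : ∀ {a ℓ} {V : Set a} → Pred V ℓ → Set (a ⊔ ℓ)
NonEmpty {V = V} Z = Σ V Z

Finite : ∀ {a ℓ} {V : Set a} → Pred V ℓ → Set (a ⊔ ℓ)
Finite {V = V} Z = Σ (List V) λ xs → ∀ v → Z v → v ∈ xs

record IsChromaticComplex {C : Set} {ℓ : Level} (V : Set ℓ)
         (F : Pred (Pred V ℓ) ℓ) (χ : V → C) : Set (lsuc ℓ) where
  field
    V-nonempty   : V
    F-nonempty   : Σ (Pred V ℓ) F
    face-nonempty : ∀ Z → F Z → NonEmpty Z
    face-finite  : ∀ Z → F Z → Finite Z
    F-closed     : ∀ Z W → F Z → NonEmpty W → W ⊆ Z → F W
    chromatic    : ∀ Z → F Z → ∀ v w → Z v → Z w → χ v ≡ χ w → v ≡ w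

IsFacet : ∀ {ℓ} {V : Set ℓ} (F : Pred (Pred V ℓ) ℓ) → Pred V ℓ → Set (lsuc ℓ)
IsFacet {ℓ} {V} F Z = F Z × (∀ (W : Pred V ℓ) → F W → Z ⊆ W → W ⊆ Z)

Fac : ∀ {ℓ} (V : Set ℓ) (F : Pred (Pred V ℓ) ℓ) → Set (lsuc ℓ)
Fac {ℓ} V F = Σ (Pred V ℓ) (IsFacet F)

-- Secrecy models over colour set C with agents A, emb : A → C
-- (plain models: C = A, emb = id;  auxiliary-colour models: C = Maybe A,
--  where nothing is the fresh colour ∗, emb = just)

record IsSecrecyModel (C A : Set) (emb : A → C) {ℓ : Level} (V : Set ℓ)
         (F : Pred (Pred V ℓ) ℓ) (χ : V → C)
         (ν : Fac V F → Pred PropVar 0ℓ)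
         (N : (a : A) (v : V) → χ v ≡ emb a → Pred (Pred (Fac V F) ℓ) (lsuc ℓ))
         : Set (lsuc ℓ) where
  field
    complex : IsChromaticComplex V F χ
    full    : (X : Fac V F) (c : C) → Σ V λ v → proj₁ X v × χ v ≡ c
    covered : (v : V) → Σ (Fac V F) λ X → proj₁ X v
    SN      : ∀ (a : A) (v : V) (p : χ v ≡ emb a) (U : Pred (Fac V F) ℓ) →
              N a v p U → ∀ (X : Fac V F) → proj₁ X v → ∀ (b : A) → b ≢ a →
              Σ (Fac V F) λ Y →
                (proj₁ (full X (emb b)) ≡ proj₁ (full Y (emb b))) × ¬ U Y

record SecrecyModel (C A : Set) (emb : A → C) (ℓ : Level) : Set (lsuc (lsuc ℓ)) where
  field
    V   : Set ℓ
    F   : Pred (Pred V ℓ) ℓ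
    χ   : V → C
    ν   : Fac V F → Pred PropVar 0ℓ
    N   : (a : A) (v : V) → χ v ≡ emb a → Pred (Pred (Fac V F) ℓ) (lsuc ℓ)
    isModel : IsSecrecyModel C A emb V F χ ν N
  open IsSecrecyModel isModel public
  Facet : Set (lsuc ℓ)
  Facet = Fac V F
  vtx : Facet → C → V
  vtx X c = proj₁ (full X c)

SimplicialSecrecyModel : (A : Set) (ℓ : Level) → Set (lsuc (lsuc ℓ))
SimplicialSecrecyModel A ℓ = SecrecyModel A A (λ a → a) ℓ

AuxSecrecyModel : (A : Set) (ℓ : Level) → Set (lsuc (lsuc ℓ))
AuxSecrecyModel A ℓ = SecrecyModel (Maybe A) A just ℓ

record FreeAbelianGroup {ℓ : Level} (X : Set ℓ) : Set (lsuc ℓ) where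
  infixl 7 _∙_
  field
    Carrier : Set ℓ
    _∙_     : Carrier → Carrier → Carrier
    ε       : Carrier
    _⁻¹     : Carrier → Carrier
    isAbelianGroup : IsAbelianGroup _≡_ _∙_ ε _⁻¹
    ι       : X → Carrier
    ι-injective : ∀ x y → ι x ≡ ι y → x ≡ y
    universal : (H : AbelianGroup ℓ ℓ) (f : X → AbelianGroup.Carrier H) →
      let open AbelianGroup H renaming (Carrier to |H|; _≈_ to _≈H_; _∙_ to _∙H_) in
      Σ (Carrier → |H|) λ h →
        (∀ x y → h (x ∙ y) ≈H (h x ∙H h y)) ×
        (∀ x → h (ι x) ≈H f x) ×
        (∀ (h′ : Carrier → |H|) → (∀ x y → h′ (x ∙ y) ≈H (h′ x ∙H h′ y)) →
           (∀ x → h′ (ι x) ≈H f x) → ∀ g → h′ g ≈H h g)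

module Share {n : ℕ} {ℓ : Level} (M : AuxSecrecyModel (Fin n) ℓ)
             (G : FreeAbelianGroup (SecrecyModel.Facet M)) where
  open SecrecyModel M using () renaming (V to V∗; F to F∗; χ to χ∗; ν to ν∗;
                                          N to N∗; Facet to Fac∗; vtx to vtx∗)
  open FreeAbelianGroup G

  sumA : ∀ {m} → (Fin m → Carrier) → Carrier
  sumA {ℕ.zero}  σ = ε
  sumA {ℕ.suc m} σ = σ zero ∙ sumA (σ ∘ suc)

  Shares : Fac∗ → Set (lsuc ℓ)
  Shares X = Σ (Fin n → Carrier) λ σ → sumA σ ≡ ι X

  Triple : Set (lsuc ℓ)
  Triple = Fin n × V∗ × Carrier

  Occurs : Triple → Set (lsuc ℓ)
  Occurs (a , v , g) = Σ Fac∗ λ X → Σ (Shares X) λ σ →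
                         (v ≡ vtx∗ X (just a)) × (g ≡ proj₁ σ a)

  VSh : Set (lsuc ℓ)
  VSh = Refinement Triple Occurs

  _^_ : (X : Fac∗) → Shares X → Pred VSh (lsuc ℓ)
  (X ^ σ) ((a , v , g) , _) = (v ≡ vtx∗ X (just a)) × (g ≡ proj₁ σ a)

  FSh : Pred (Pred VSh (lsuc ℓ)) (lsuc ℓ)
  FSh Z = NonEmpty Z × Finite Z × Σ Fac∗ λ X → Σ (Shares X) λ σ → Z ⊆ (X ^ σ)

  χSh : VSh → Fin n
  χSh ((a , _ , _) , _) = a

  FacSh : Set (lsuc (lsuc ℓ))
  FacSh = Fac VSh FSh

  νSh : FacSh → Pred PropVar 0ℓ
  νSh (Z , (_ , _ , X , _ , _) , _) = ν∗ X

  _↑ : Pred Fac∗ ℓ → Pred FacSh (lsuc ℓ)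
  (U ↑) Z = Σ Fac∗ λ Y → U Y × Σ (Shares Y) λ τ → proj₁ Z ≐ (Y ^ τ)

  NSh : (a : Fin n) (x : VSh) → χSh x ≡ a → Pred (Pred FacSh (lsuc ℓ)) (lsuc (lsuc ℓ))
  NSh a ((_ , v , _) , _) _ 𝒰 =
    Σ (Pred Fac∗ ℓ) λ U → Σ (χ∗ v ≡ just a) λ q → N∗ a v q U × (𝒰 ≐ (U ↑))

-- A facet X^σ of the share model is the facet X of M∗ split into additive
-- shares of ι(X); it has one vertex of each colour, and it determines X
-- because its shares sum to ι(X) and ι is injective.  With at least two
-- agents any single share can be prescribed, a second agent absorbing the
-- difference.  This puts every vertex (a, v, g) into a facet, and turns a
-- witness Y ∉ U of (SN) in M∗ into a facet Y^τ ∉ U↑ that shares the b-vertex,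
-- share included, with the given facet.
module Submission where

open import Defs
open import Level using (Level)
open import Data.Nat as ℕ using (ℕ; _≤_; s≤s)
open import Data.Fin using (Fin; zero; suc; punchIn)
open import Data.Fin.Properties using (punchInᵢ≢i) renaming (_≟_ to _≟ᶠ_)
open import Data.Maybe using (just)
open import Data.Maybe.Properties using (≡-dec)
open import Data.Product using (Σ; ∃; _×_; _,_; proj₁; proj₂)
open import Data.List using (map; allFin)
open import Data.List.Membership.Propositional using (_∈_)
open import Data.List.Membership.Propositional.Properties using (∈-map⁺; ∈-allFin)
open import Data.Refinement using (_,_; value-injective)
open import Data.Irrelevant using ([_])
open import Data.Vec.Functional using (Vector)
open import Relation.Nullary using (¬_; contradiction)
open import Relation.Nullary.Decidable.Core using (recompute)
open import Relation.Unary using (Pred; _⊆_)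
open import Relation.Binary.PropositionalEquality
open import Algebra.Bundles using (CommutativeMonoid; AbelianGroup)
open import Function using (_∘_)

module SingleSum {c ℓ} (M : CommutativeMonoid c ℓ) where
  open CommutativeMonoid M using (Carrier; _≈_; _∙_; ε; ∙-cong; ∙-congˡ; identityˡ; identityʳ)
    renaming (trans to ≈-trans; reflexive to ≈-reflexive)
  open import Algebra.Properties.CommutativeMonoid.Sum M
    using (sum; ∑-distrib-+; sum-replicate-zero)

  single : ∀ {k} → Fin k → Carrier → Vector Carrier k
  single zero    x zero    = x
  single zero    x (suc _) = ε
  single (suc a) x zero    = ε
  single (suc a) x (suc i) = single a x i

  single-same : ∀ {k} (a : Fin k) x → single a x a ≡ x
  single-same zero    x = refl
  single-same (suc a) x = single-same a x

  single-other : ∀ {k} {a b : Fin k} x → a ≢ b → single a x b ≡ ε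
  single-other {a = zero}  {zero}  x a≢b = contradiction refl a≢b
  single-other {a = zero}  {suc b} x a≢b = refl
  single-other {a = suc a} {zero}  x a≢b = refl
  single-other {a = suc a} {suc b} x a≢b = single-other x (a≢b ∘ cong suc)

  sum-single : ∀ {k} (a : Fin k) x → sum (single a x) ≈ x
  sum-single {ℕ.suc k} zero x = ≈-trans (∙-congˡ (sum-replicate-zero k)) (identityʳ x)
  sum-single (suc a) x = ≈-trans (identityˡ _) (sum-single a x)

  pair : ∀ {k} → Fin k → Fin k → Carrier → Carrier → Vector Carrier k
  pair a b x y i = single a x i ∙ single b y i

  sum-pair : ∀ {k} (a b : Fin k) x y → sum (pair a b x y) ≈ x ∙ y
  sum-pair a b x y = ≈-trans (∑-distrib-+ (single a x) (single b y))
                             (∙-cong (sum-single a x) (sum-single b y))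

  pair-first : ∀ {k} {a b : Fin k} x y → a ≢ b → pair a b x y a ≈ x
  pair-first {a = a} x y a≢b =
    ≈-trans (≈-reflexive (cong₂ _∙_ (single-same a x) (single-other y (≢-sym a≢b))))
            (identityʳ x)

module _ {C A : Set} {emb : A → C} {ℓ : Level} (M : SecrecyModel C A emb ℓ) where
  open SecrecyModel M

  vtx-unique : (X : Facet) {v : V} {c : C} → proj₁ X v → χ v ≡ c → v ≡ vtx X c
  vtx-unique X@(Z , FZ , _) {v} {c} v∈X χv≡c =
    chromatic Z FZ v (vtx X c) v∈X vtx∈X (trans χv≡c (sym χvtx≡c))
    where
    open IsChromaticComplex complex using (chromatic)
    vtx∈X = proj₁ (proj₂ (full X c))
    χvtx≡c = proj₂ (proj₂ (full X c))

-- Faces of the share model need at least one agent, hence Fin (1 + k).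
module ShareModel {k : ℕ} {ℓ : Level} (M : AuxSecrecyModel (Fin (ℕ.suc k)) ℓ)
                  (G : FreeAbelianGroup (SecrecyModel.Facet M)) where
  n : ℕ
  n = ℕ.suc k

  open SecrecyModel M using (χ; vtx; full; covered; SN; complex) renaming (Facet to Fac∗)
  open Share M G
  open FreeAbelianGroup G

  abelianGroup : AbelianGroup _ _
  abelianGroup = record { isAbelianGroup = isAbelianGroup }

  open AbelianGroup abelianGroup using (commutativeMonoid)
  open import Algebra.Properties.AbelianGroup abelianGroup using (\\-leftDividesˡ)
  open import Algebra.Properties.CommutativeMonoid.Sum commutativeMonoid using (sum; sum-cong-≗)
  open SingleSum commutativeMonoid using (pair; sum-pair; pair-first)

  sumA≡sum : ∀ {m} (σ : Vector Carrier m) → sumA σ ≡ sum σ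
  sumA≡sum {ℕ.zero}  σ = refl
  sumA≡sum {ℕ.suc m} σ = cong (σ zero ∙_) (sumA≡sum (σ ∘ suc))

  splitShares : (X : Fac∗) (a b : Fin n) (g : Carrier) → Shares X
  splitShares X a b g = pair a b g (g ⁻¹ ∙ ι X) , (begin
    sumA (pair a b g (g ⁻¹ ∙ ι X)) ≡⟨ sumA≡sum (pair a b g (g ⁻¹ ∙ ι X)) ⟩
    sum (pair a b g (g ⁻¹ ∙ ι X))  ≡⟨ sum-pair a b g _ ⟩
    g ∙ (g ⁻¹ ∙ ι X)               ≡⟨ \\-leftDividesˡ g (ι X) ⟩
    ι X                            ∎)
    where open ≡-Reasoning

  splitShares-first : ∀ X {a b} g → a ≢ b → proj₁ (splitShares X a b g) a ≡ g
  splitShares-first X g = pair-first g (g ⁻¹ ∙ ι X)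

  vertex : (X : Fac∗) → Shares X → Fin n → VSh
  vertex X σ a = (a , vtx X (just a) , proj₁ σ a) , [ (X , σ , refl , refl) ]

  vertex∈^ : (X : Fac∗) (σ : Shares X) (a : Fin n) → (X ^ σ) (vertex X σ a)
  vertex∈^ X σ a = refl , refl

  ∈^⇒≡vertex : (X : Fac∗) (σ : Shares X) {w : VSh} → (X ^ σ) w → w ≡ vertex X σ (χSh w)
  ∈^⇒≡vertex X σ (refl , refl) = value-injective refl

  ^-chromatic : (X : Fac∗) (σ : Shares X) {v w : VSh} →
                (X ^ σ) v → (X ^ σ) w → χSh v ≡ χSh w → v ≡ w
  ^-chromatic X σ {v} {w} v∈ w∈ χv≡χw = begin
    v                     ≡⟨ ∈^⇒≡vertex X σ v∈ ⟩
    vertex X σ (χSh v)    ≡⟨ cong (vertex X σ) χv≡χw ⟩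
    vertex X σ (χSh w)    ≡⟨ ∈^⇒≡vertex X σ w∈ ⟨
    w                     ∎
    where open ≡-Reasoning

  ^-face : (X : Fac∗) (σ : Shares X) → FSh (X ^ σ)
  ^-face X σ = (vertex X σ zero , vertex∈^ X σ zero) , (vertices , listed) , X , σ , (λ w∈ → w∈)
    where
    vertices = map (vertex X σ) (allFin n)
    listed : ∀ w → (X ^ σ) w → w ∈ vertices
    listed w w∈ = subst (_∈ vertices) (sym (∈^⇒≡vertex X σ w∈))
                        (∈-map⁺ (vertex X σ) (∈-allFin (χSh w)))

  ^-facet : (X : Fac∗) (σ : Shares X) → IsFacet FSh (X ^ σ)
  ^-facet X σ = ^-face X σ , maximal
    where
    maximal : ∀ W → FSh W → (X ^ σ) ⊆ W → W ⊆ (X ^ σ)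
    maximal W (_ , _ , Y , τ , W⊆Y^τ) X^σ⊆W {w} w∈W =
      subst (X ^ σ) (sym w≡vertex) (vertex∈^ X σ (χSh w))
      where
      vertex∈W : W (vertex X σ (χSh w))
      vertex∈W = X^σ⊆W {vertex X σ (χSh w)} (vertex∈^ X σ (χSh w))
      w≡vertex : w ≡ vertex X σ (χSh w)
      w≡vertex = ^-chromatic Y τ (W⊆Y^τ w∈W) (W⊆Y^τ {vertex X σ (χSh w)} vertex∈W) refl

  shareFacet : (X : Fac∗) → Shares X → FacSh
  shareFacet X σ = X ^ σ , ^-facet X σ

  ^-determines : (X Y : Fac∗) (σ : Shares X) (τ : Shares Y) → (X ^ σ) ⊆ (Y ^ τ) → X ≡ Y
  ^-determines X Y (σ , ∑σ≡ιX) (τ , ∑τ≡ιY) X^σ⊆Y^τ = ι-injective X Y (begin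
    ι X     ≡⟨ ∑σ≡ιX ⟨
    sumA σ  ≡⟨ sumA≡sum σ ⟩
    sum σ   ≡⟨ sum-cong-≗ σ≗τ ⟩
    sum τ   ≡⟨ sumA≡sum τ ⟨
    sumA τ  ≡⟨ ∑τ≡ιY ⟩
    ι Y     ∎)
    where
    open ≡-Reasoning
    σ≗τ : ∀ a → σ a ≡ τ a
    σ≗τ a = proj₂ (X^σ⊆Y^τ {vertex X (σ , ∑σ≡ιX) a} (vertex∈^ X (σ , ∑σ≡ιX) a))

  shareFacet∈↑⇒∈ : (U : Pred Fac∗ ℓ) (Y : Fac∗) (τ : Shares Y) → (U ↑) (shareFacet Y τ) → U Y
  shareFacet∈↑⇒∈ U Y τ (Y′ , Y′∈U , τ′ , Y^τ⊆Y′^τ′ , _) =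
    subst U (sym (^-determines Y Y′ τ τ′ (λ {w} → Y^τ⊆Y′^τ′ {w}))) Y′∈U

  isChromaticComplex : IsChromaticComplex VSh FSh χSh
  isChromaticComplex = record
    { V-nonempty    = vertex X₀ σ₀ zero
    ; F-nonempty    = X₀ ^ σ₀ , ^-face X₀ σ₀
    ; face-nonempty = λ _ FZ → proj₁ FZ
    ; face-finite   = λ _ FZ → proj₁ (proj₂ FZ)
    ; F-closed      = λ { Z W (_ , (vs , listed) , X , σ , Z⊆X^σ) W-nonempty W⊆Z →
                          W-nonempty , (vs , λ w → listed w ∘ W⊆Z) , X , σ , Z⊆X^σ ∘ W⊆Z }
    ; chromatic     = λ { Z (_ , _ , X , σ , Z⊆X^σ) v w v∈Z w∈Z →
                          ^-chromatic X σ (Z⊆X^σ v∈Z) (Z⊆X^σ w∈Z) }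
    }
    where
    open IsChromaticComplex complex using () renaming (V-nonempty to v₀)
    X₀ = proj₁ (covered v₀)
    σ₀ = splitShares X₀ zero zero ε

  fullSh : (Z : FacSh) (c : Fin n) → Σ VSh λ v → proj₁ Z v × χSh v ≡ c
  fullSh (Z , (_ , _ , X , σ , Z⊆X^σ) , maximal) c =
    vertex X σ c , maximal (X ^ σ) (^-face X σ) Z⊆X^σ (vertex∈^ X σ c) , refl

  occurs-colour : ∀ {a v g} → Occurs (a , v , g) → χ v ≡ just a
  occurs-colour {a} (X , _ , v≡vtx , _) = trans (cong χ v≡vtx) (proj₂ (proj₂ (full X (just a))))

  coveredSh : ((a : Fin n) → ∃ λ b → a ≢ b) → (x : VSh) → Σ FacSh λ Z → proj₁ Z x
  coveredSh partner ((a , v , g) , [ occ ]) =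
    shareFacet X σ , vtx-unique M X v∈X χv≡a , sym (splitShares-first X g a≢b)
    where
    -- The occurrence proof is irrelevant, so the colour is recomputed by decision.
    χv≡a : χ v ≡ just a
    χv≡a = recompute (≡-dec _≟ᶠ_ (χ v) (just a)) (occurs-colour occ)
    X = proj₁ (covered v)
    v∈X = proj₂ (covered v)
    a≢b = proj₂ (partner a)
    σ = splitShares X a (proj₁ (partner a)) g

  SNSh : ∀ (a : Fin n) (x : VSh) (p : χSh x ≡ a) (𝒰 : Pred FacSh (Level.suc ℓ)) →
         NSh a x p 𝒰 → ∀ (Z : FacSh) → proj₁ Z x → ∀ (b : Fin n) → b ≢ a →
         Σ FacSh λ Y → (proj₁ (fullSh Z b) ≡ proj₁ (fullSh Y b)) × ¬ 𝒰 Y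
  SNSh a ((.a , v , g) , _) refl 𝒰 (U , χv≡a , U∈N , 𝒰⊆U↑ , _)
       (Z , (_ , _ , X , σ , Z⊆X^σ) , _) x∈Z b b≢a =
    shareFacet Y τ , same-b-vertex , Y^τ∉𝒰
    where
    v∈X : proj₁ X v
    v∈X = subst (proj₁ X) (sym (proj₁ (Z⊆X^σ x∈Z))) (proj₁ (proj₂ (full X (just a))))
    witness = SN a v χv≡a U U∈N X v∈X b b≢a
    Y = proj₁ witness
    τ = splitShares Y b a (proj₁ σ b)
    same-b-vertex : vertex X σ b ≡ vertex Y τ b
    same-b-vertex = value-injective (cong₂ (λ w h → b , w , h)
      (proj₁ (proj₂ witness)) (sym (splitShares-first Y (proj₁ σ b) b≢a)))
    Y^τ∉𝒰 : ¬ 𝒰 (shareFacet Y τ)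
    Y^τ∉𝒰 = proj₂ (proj₂ witness) ∘ shareFacet∈↑⇒∈ U Y τ ∘ 𝒰⊆U↑

  isSecrecyModel : ((a : Fin n) → ∃ λ b → a ≢ b) →
                   IsSecrecyModel (Fin n) (Fin n) (λ a → a) VSh FSh χSh νSh NSh
  isSecrecyModel partner = record
    { complex = isChromaticComplex
    ; full    = fullSh
    ; covered = coveredSh partner
    ; SN      = SNSh
    }

partner : ∀ {n} → 2 ≤ n → (a : Fin n) → ∃ λ b → a ≢ b
partner (s≤s (s≤s _)) a = punchIn a zero , ≢-sym (punchInᵢ≢i a zero)

lemma5p21 : ∀ {ℓ : Level} (n : ℕ) → 2 ≤ n →
            (M : AuxSecrecyModel (Fin n) ℓ)
            (G : FreeAbelianGroup (SecrecyModel.Facet M)) →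
            IsSecrecyModel (Fin n) (Fin n) (λ a → a)
              (Share.VSh M G) (Share.FSh M G) (Share.χSh M G)
              (Share.νSh M G) (Share.NSh M G)
lemma5p21 (ℕ.suc _) 2≤n M G = ShareModel.isSecrecyModel M G (partner 2≤n)
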